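{- Let $k\ge 2$ be an integer and let $F$ be a field with more than $k$ distinct elements whose characteristic does not divide $k$. Then every polynomial $P\in F[x_1,\ldots,x_n]$ of degree $d$ can be written as $$P=\delta_1Q_1^k+\cdots+\delta_kQ_k^k,$$ with $\delta_1,\ldots,\delta_k\in F$ and $Q_1,\ldots,Q_k\in F[x_1,\ldots,x_n]$ satisfying $\deg Q_i^k\le kd$. If moreover every element of $F$ is a sum of $w_F(k)$ $k$th powers of elements of $F$, then $$P=Q_1^k+\cdots+Q_s^k$$ for some $s\le k\,w_F(k)$ and some $Q_1,\ldots,Q_s\in F[x_1,\ldots,x_n]$ with $\deg Q_i^k\le kd$.
   Context: $w_F(k)$ denotes the least integer $s$ such that every element of $F$ is a sum of $s$ $k$th powers of elements of $F$ (assumed finite in the second part). -}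

module Defs where

open import Level using (Level; _⊔_)
open import Data.Nat.Base as ℕ using (ℕ; zero; suc)
open import Data.Nat.Divisibility using (_∣_)
open import Data.Fin.Base using (Fin)
open import Data.List.Base using (List; []; _∷_; map)
open import Data.Product.Base using (Σ; ∃; _×_; _,_)
open import Data.Unit.Polymorphic using (⊤)
open import Relation.Binary.PropositionalEquality using (_≡_)
open import Relation.Nullary using (¬_)
open import Algebra.Bundles using (RawSemiring; Semiring; CommutativeRing)
import Algebra.Definitions.RawSemiring as RSDefs

private variable c ℓ : Level

rawSR : CommutativeRing c ℓ → RawSemiring c ℓ
rawSR R = Semiring.rawSemiring (CommutativeRing.semiring R)

IsField : CommutativeRing c ℓ → Set (c ⊔ ℓ)
IsField R = (¬ (1# ≈ 0#)) × (∀ x → ¬ (x ≈ 0#) → ∃ λ y → x * y ≈ 1#)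
  where open CommutativeRing R

-- The characteristic: p is the characteristic of R iff for every m,
-- m·1 = 0 in R exactly when p divides m  (p = 0 for characteristic zero).
IsCharacteristic : (R : CommutativeRing c ℓ) → ℕ → Set ℓ
IsCharacteristic R p =
  ∀ m → ((m ⊠ 1#) ≈ 0# → p ∣ m) × (p ∣ m → (m ⊠ 1#) ≈ 0#)
  where
    open CommutativeRing R
    open RSDefs (rawSR R) using () renaming (_×_ to _⊠_)

MoreThan : (R : CommutativeRing c ℓ) → ℕ → Set (c ⊔ ℓ)
MoreThan R k = ∃ λ (f : Fin (suc k) → Carrier) → ∀ i j → f i ≈ f j → i ≡ j
  where open CommutativeRing R

SumOfPowers : (R : CommutativeRing c ℓ) → ℕ → ℕ → CommutativeRing.Carrier R → Set (c ⊔ ℓ)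
SumOfPowers R k s a = ∃ λ (y : Fin s → Carrier) → a ≈ sum (λ i → y i ^ k)
  where
    open CommutativeRing R
    open RSDefs (rawSR R) using (_^_; sum)

-- w is w_R(k): the least s such that every element of R is a sum of
-- s k-th powers (its existence = finiteness of w_R(k)).
IsWaringNumber : (R : CommutativeRing c ℓ) → ℕ → ℕ → Set (c ⊔ ℓ)
IsWaringNumber R k w =
  (∀ a → SumOfPowers R k w a) ×
  (∀ s → (∀ a → SumOfPowers R k s a) → w ℕ.≤ s)

-- Univariate polynomials over a raw semiring, as coefficient lists
-- (constant term first), with equality up to trailing zero coefficients.

module PolyOver (A : RawSemiring c ℓ) where
  open RawSemiring A

  Poly : Set c
  Poly = List Carrier

  infix 4 _≋_
  _≋_ : Poly → Poly → Set ℓ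
  []       ≋ []       = ⊤
  []       ≋ (b ∷ bs) = (b ≈ 0#) × ([] ≋ bs)
  (a ∷ as) ≋ []       = (a ≈ 0#) × (as ≋ [])
  (a ∷ as) ≋ (b ∷ bs) = (a ≈ b) × (as ≋ bs)

  infixl 6 _⊕_
  _⊕_ : Poly → Poly → Poly
  []       ⊕ q        = q
  (a ∷ as) ⊕ []       = a ∷ as
  (a ∷ as) ⊕ (b ∷ bs) = (a + b) ∷ (as ⊕ bs)

  infixl 7 _⊗_
  _⊗_ : Poly → Poly → Poly
  []       ⊗ q = []
  (a ∷ as) ⊗ q = map (a *_) q ⊕ (0# ∷ (as ⊗ q))

  polyRawSemiring : RawSemiring c ℓ
  polyRawSemiring = record
    { Carrier = Poly ; _≈_ = _≋_ ; _+_ = _⊕_ ; _*_ = _⊗_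
    ; 0# = [] ; 1# = 1# ∷ [] }

-- Multivariate polynomials A[x₁,…,xₙ] = A[x₁,…,xₙ₋₁][xₙ].

MPoly : RawSemiring c ℓ → ℕ → RawSemiring c ℓ
MPoly A zero    = A
MPoly A (suc n) = PolyOver.polyRawSemiring (MPoly A n)

const : (A : RawSemiring c ℓ) (n : ℕ) → RawSemiring.Carrier A → RawSemiring.Carrier (MPoly A n)
const A zero    a = a
const A (suc n) a = const A n a ∷ []

DegLe : (A : RawSemiring c ℓ) (n : ℕ) → ℕ → RawSemiring.Carrier (MPoly A n) → Set ℓ
DegLe A zero    d       p        = ⊤
DegLe A (suc n) d       []       = ⊤
DegLe A (suc n) zero    (p ∷ ps) = DegLe A n zero p × PolyOver._≋_ (MPoly A n) ps []
DegLe A (suc n) (suc d) (p ∷ ps) = DegLe A n (suc d) p × DegLe A (suc n) d ps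

-- total degree is exactly d: least d with DegLe d
-- (so the zero polynomial is given degree 0)
HasDegree : (A : RawSemiring c ℓ) (n : ℕ) → ℕ → RawSemiring.Carrier (MPoly A n) → Set ℓ
HasDegree A n d p = DegLe A n d p × (∀ e → DegLe A n e p → d ℕ.≤ e)

module _ (F : CommutativeRing c ℓ) (n : ℕ) where
  private R = MPoly (rawSR F) n

  Pol : Set c
  Pol = RawSemiring.Carrier R

  _≈ₚ_ : Pol → Pol → Set ℓ
  _≈ₚ_ = RawSemiring._≈_ R

  _*ₚ_ : Pol → Pol → Pol
  _*ₚ_ = RawSemiring._*_ R

  _^ₚ_ : Pol → ℕ → Pol
  _^ₚ_ = RSDefs._^_ R

  ∑ₚ : ∀ {m} → (Fin m → Pol) → Pol
  ∑ₚ = RSDefs.sum R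

  constₚ : CommutativeRing.Carrier F → Pol
  constₚ = const (rawSR F) n

  DegLeₚ : ℕ → Pol → Set ℓ
  DegLeₚ = DegLe (rawSR F) n

  HasDegreeₚ : ℕ → Pol → Set ℓ
  HasDegreeₚ = HasDegree (rawSR F) n

module Submission where

-- Pick k distinct elements b₀,…,b_{k−1} of F and weights δᵢ with
-- Σᵢ δᵢ bᵢᵐ = 0 for m < k − 1 and Σᵢ δᵢ bᵢ^{k−1} = 1 (they exist since the
-- bᵢ are distinct).  With γᵢ = δᵢ/k the binomial theorem gives
-- Σᵢ γᵢ (y + bᵢ)ᵏ = c₀ + y for a constant c₀ ∈ F, so every polynomial P
-- equals Σᵢ γᵢ (P − c₀ + bᵢ)ᵏ, each k-th power of degree ≤ k · deg P.  If
-- moreover γᵢ = Σⱼ yᵢⱼᵏ in F, then γᵢ Qᵢᵏ = Σⱼ (yᵢⱼ Qᵢ)ᵏ, and P is a sum of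
-- k · w k-th powers.

open import Level using (Level; _⊔_)
open import Data.Nat.Base as ℕ using (ℕ; zero; suc)
open import Data.Fin.Base using (Fin; zero; suc; toℕ; splitAt)
open import Data.Product.Base using (Σ; ∃; _×_; _,_; proj₁; proj₂)
open import Data.Unit.Polymorphic using (tt)
open import Function.Base using (_∘_)
open import Relation.Binary.PropositionalEquality as ≡ using (_≡_)
open import Relation.Nullary using (¬_)
import Data.Nat.Properties as ℕ
open import Data.Fin.Properties using (suc-injective)
open import Algebra.Bundles using (RawSemiring; CommutativeSemiring; CommutativeRing)
open import Algebra.Structures using (IsCommutativeSemiring)
open import Algebra.Structures.Biased using (isCommutativeSemiringˡ)
open import Relation.Binary.Structures using (IsEquivalence)
open import Relation.Binary.Bundles using (Setoid)
import Relation.Binary.Reasoning.Setoid as SetoidReasoning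
import Algebra.Definitions.RawSemiring as RSDefs
open import Algebra.Morphism.Structures using (module SemiringMorphisms)
open SemiringMorphisms using (IsSemiringHomomorphism)
open import Defs

-- Equality of coefficient lists is coefficientwise equality, so the
-- additive laws are checked one coefficient at a time; the
-- multiplicative laws follow by induction on the first factor.
module PolynomialSemiring {c ℓ} (A : RawSemiring c ℓ)
  (isCS : IsCommutativeSemiring (RawSemiring._≈_ A) (RawSemiring._+_ A)
            (RawSemiring._*_ A) (RawSemiring.0# A) (RawSemiring.1# A)) where
  open import Data.List.Base using ([]; _∷_; map)
  open RawSemiring A
  open IsCommutativeSemiring isCS hiding (zero)
  open PolyOver A

  coeff : Poly → ℕ → Carrier
  coeff []       i       = 0#
  coeff (a ∷ as) zero    = a
  coeff (a ∷ as) (suc i) = coeff as i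

  ≋⇒coeff : ∀ {p q} → p ≋ q → ∀ i → coeff p i ≈ coeff q i
  ≋⇒coeff {[]}     {[]}     _         i       = refl
  ≋⇒coeff {[]}     {b ∷ bs} (b≈0 , _) zero    = sym b≈0
  ≋⇒coeff {[]}     {b ∷ bs} (_ , e)   (suc i) = ≋⇒coeff {[]} {bs} e i
  ≋⇒coeff {a ∷ as} {[]}     (a≈0 , _) zero    = a≈0
  ≋⇒coeff {a ∷ as} {[]}     (_ , e)   (suc i) = ≋⇒coeff {as} {[]} e i
  ≋⇒coeff {a ∷ as} {b ∷ bs} (a≈b , _) zero    = a≈b
  ≋⇒coeff {a ∷ as} {b ∷ bs} (_ , e)   (suc i) = ≋⇒coeff e i

  coeff⇒≋ : ∀ {p q} → (∀ i → coeff p i ≈ coeff q i) → p ≋ q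
  coeff⇒≋ {[]}     {[]}     e = tt
  coeff⇒≋ {[]}     {b ∷ bs} e = sym (e zero) , coeff⇒≋ {[]} {bs} (e ∘ suc)
  coeff⇒≋ {a ∷ as} {[]}     e = e zero , coeff⇒≋ {as} {[]} (e ∘ suc)
  coeff⇒≋ {a ∷ as} {b ∷ bs} e = e zero , coeff⇒≋ (e ∘ suc)

  ≋-isEquivalence : IsEquivalence _≋_
  ≋-isEquivalence = record
    { refl  = coeff⇒≋ (λ i → refl)
    ; sym   = λ e → coeff⇒≋ (λ i → sym (≋⇒coeff e i))
    ; trans = λ e e′ → coeff⇒≋ (λ i → trans (≋⇒coeff e i) (≋⇒coeff e′ i))
    }

  open IsEquivalence ≋-isEquivalence
    using () renaming (refl to ≋-refl; sym to ≋-sym; trans to ≋-trans)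

  ≋-setoid : Setoid c ℓ
  ≋-setoid = record { isEquivalence = ≋-isEquivalence }

  -- multiplication of every coefficient by a scalar; p ⊗ q is defined
  -- through it, since (a ∷ as) ⊗ q = scale a q ⊕ (0# ∷ as ⊗ q)
  scale : Carrier → Poly → Poly
  scale a = map (a *_)

  coeff-⊕ : ∀ p q i → coeff (p ⊕ q) i ≈ coeff p i + coeff q i
  coeff-⊕ []       q        i       = sym (+-identityˡ _)
  coeff-⊕ (a ∷ as) []       i       = sym (+-identityʳ _)
  coeff-⊕ (a ∷ as) (b ∷ bs) zero    = refl
  coeff-⊕ (a ∷ as) (b ∷ bs) (suc i) = coeff-⊕ as bs i

  coeff-scale : ∀ a q i → coeff (scale a q) i ≈ a * coeff q i
  coeff-scale a []       i       = sym (zeroʳ a)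
  coeff-scale a (b ∷ bs) zero    = refl
  coeff-scale a (b ∷ bs) (suc i) = coeff-scale a bs i

  ⊕-cong : ∀ {p p′ q q′} → p ≋ p′ → q ≋ q′ → p ⊕ q ≋ p′ ⊕ q′
  ⊕-cong {p} {p′} {q} {q′} e e′ = coeff⇒≋ λ i → begin
    coeff (p ⊕ q) i          ≈⟨ coeff-⊕ p q i ⟩
    coeff p i + coeff q i    ≈⟨ +-cong (≋⇒coeff e i) (≋⇒coeff e′ i) ⟩
    coeff p′ i + coeff q′ i  ≈⟨ coeff-⊕ p′ q′ i ⟨
    coeff (p′ ⊕ q′) i        ∎
    where open SetoidReasoning setoid

  ⊕-assoc : ∀ p q r → (p ⊕ q) ⊕ r ≋ p ⊕ (q ⊕ r)
  ⊕-assoc p q r = coeff⇒≋ λ i → begin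
    coeff ((p ⊕ q) ⊕ r) i                ≈⟨ trans (coeff-⊕ (p ⊕ q) r i) (+-congʳ (coeff-⊕ p q i)) ⟩
    (coeff p i + coeff q i) + coeff r i  ≈⟨ +-assoc _ _ _ ⟩
    coeff p i + (coeff q i + coeff r i)  ≈⟨ trans (coeff-⊕ p (q ⊕ r) i) (+-congˡ (coeff-⊕ q r i)) ⟨
    coeff (p ⊕ (q ⊕ r)) i                ∎
    where open SetoidReasoning setoid

  ⊕-comm : ∀ p q → p ⊕ q ≋ q ⊕ p
  ⊕-comm p q = coeff⇒≋ λ i → begin
    coeff (p ⊕ q) i        ≈⟨ coeff-⊕ p q i ⟩
    coeff p i + coeff q i  ≈⟨ +-comm _ _ ⟩
    coeff q i + coeff p i  ≈⟨ coeff-⊕ q p i ⟨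
    coeff (q ⊕ p) i        ∎
    where open SetoidReasoning setoid

  ⊕-identityʳ : ∀ p → p ⊕ [] ≋ p
  ⊕-identityʳ []       = tt
  ⊕-identityʳ (a ∷ as) = ≋-refl {a ∷ as}

  scale-cong : ∀ {a b p q} → a ≈ b → p ≋ q → scale a p ≋ scale b q
  scale-cong {a} {b} {p} {q} e e′ = coeff⇒≋ λ i →
    trans (coeff-scale a p i) (trans (*-cong e (≋⇒coeff e′ i)) (sym (coeff-scale b q i)))

  scale-distrib-⊕ : ∀ a p q → scale a (p ⊕ q) ≋ scale a p ⊕ scale a q
  scale-distrib-⊕ a p q = coeff⇒≋ λ i → begin
    coeff (scale a (p ⊕ q)) i        ≈⟨ trans (coeff-scale a (p ⊕ q) i) (*-congˡ (coeff-⊕ p q i)) ⟩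
    a * (coeff p i + coeff q i)      ≈⟨ distribˡ a _ _ ⟩
    a * coeff p i + a * coeff q i    ≈⟨ trans (coeff-⊕ (scale a p) (scale a q) i) (+-cong (coeff-scale a p i) (coeff-scale a q i)) ⟨
    coeff (scale a p ⊕ scale a q) i  ∎
    where open SetoidReasoning setoid

  scale-distrib-+ : ∀ a b p → scale (a + b) p ≋ scale a p ⊕ scale b p
  scale-distrib-+ a b p = coeff⇒≋ λ i → begin
    coeff (scale (a + b) p) i        ≈⟨ coeff-scale (a + b) p i ⟩
    (a + b) * coeff p i              ≈⟨ distribʳ _ a b ⟩
    a * coeff p i + b * coeff p i    ≈⟨ trans (coeff-⊕ (scale a p) (scale b p) i) (+-cong (coeff-scale a p i) (coeff-scale b p i)) ⟨
    coeff (scale a p ⊕ scale b p) i  ∎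
    where open SetoidReasoning setoid

  scale-scale : ∀ a b p → scale a (scale b p) ≋ scale (a * b) p
  scale-scale a b p = coeff⇒≋ λ i → begin
    coeff (scale a (scale b p)) i  ≈⟨ trans (coeff-scale a (scale b p) i) (*-congˡ (coeff-scale b p i)) ⟩
    a * (b * coeff p i)            ≈⟨ *-assoc a b _ ⟨
    a * b * coeff p i              ≈⟨ coeff-scale (a * b) p i ⟨
    coeff (scale (a * b) p) i      ∎
    where open SetoidReasoning setoid

  scale-zero : ∀ p → scale 0# p ≋ []
  scale-zero p = coeff⇒≋ λ i → trans (coeff-scale 0# p i) (zeroˡ _)

  scale-one : ∀ p → scale 1# p ≋ p
  scale-one p = coeff⇒≋ λ i → trans (coeff-scale 1# p i) (*-identityˡ _)

  shift-cong : ∀ {p q} → p ≋ q → (0# ∷ p) ≋ (0# ∷ q)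
  shift-cong e = refl , e

  ⊗-zero-lemma : ∀ b x q → b ≈ 0# → x ≋ [] → scale b q ⊕ (0# ∷ x) ≋ []
  ⊗-zero-lemma b x q b≈0 x≋0 = begin
    scale b q ⊕ (0# ∷ x)      ≈⟨ ⊕-cong (scale-cong b≈0 (≋-refl {q})) (shift-cong x≋0) ⟩
    scale 0# q ⊕ (0# ∷ [])    ≈⟨ ⊕-cong (scale-zero q) (≋-refl {0# ∷ []}) ⟩
    0# ∷ []                   ≈⟨ refl , tt ⟩
    []                        ∎
    where open SetoidReasoning ≋-setoid

  ⊗-congˡ : ∀ {p p′} q → p ≋ p′ → p ⊗ q ≋ p′ ⊗ q
  ⊗-congˡ {[]}     {[]}     q e           = tt
  ⊗-congˡ {[]}     {b ∷ bs} q (b≈0 , e)   =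
    ≋-sym (⊗-zero-lemma b (bs ⊗ q) q b≈0 (≋-sym (⊗-congˡ {[]} {bs} q e)))
  ⊗-congˡ {a ∷ as} {[]}     q (a≈0 , e)   = ⊗-zero-lemma a (as ⊗ q) q a≈0 (⊗-congˡ {as} {[]} q e)
  ⊗-congˡ {a ∷ as} {b ∷ bs} q (a≈b , e)   =
    ⊕-cong (scale-cong a≈b (≋-refl {q})) (shift-cong (⊗-congˡ q e))

  ⊗-congʳ : ∀ p {q q′} → q ≋ q′ → p ⊗ q ≋ p ⊗ q′
  ⊗-congʳ []       e = tt
  ⊗-congʳ (a ∷ as) e = ⊕-cong (scale-cong refl e) (shift-cong (⊗-congʳ as e))

  ⊗-cong : ∀ {p p′ q q′} → p ≋ p′ → q ≋ q′ → p ⊗ q ≋ p′ ⊗ q′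
  ⊗-cong {p} {p′} {q} e e′ = ≋-trans (⊗-congˡ q e) (⊗-congʳ p′ e′)

  ⊗-distribʳ : ∀ p p′ q → (p ⊕ p′) ⊗ q ≋ p ⊗ q ⊕ p′ ⊗ q
  ⊗-distribʳ []       p′       q = ≋-refl
  ⊗-distribʳ (a ∷ as) []       q = ≋-sym (⊕-identityʳ _)
  ⊗-distribʳ (a ∷ as) (b ∷ bs) q = begin
    scale (a + b) q ⊕ (0# ∷ (as ⊕ bs) ⊗ q)
      ≈⟨ ⊕-cong (scale-distrib-+ a b q) (sym (+-identityˡ 0#) , ⊗-distribʳ as bs q) ⟩
    (scale a q ⊕ scale b q) ⊕ ((0# ∷ as ⊗ q) ⊕ (0# ∷ bs ⊗ q))
      ≈⟨ ⊕-interchange (scale a q) (scale b q) (0# ∷ as ⊗ q) (0# ∷ bs ⊗ q) ⟩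
    (scale a q ⊕ (0# ∷ as ⊗ q)) ⊕ (scale b q ⊕ (0# ∷ bs ⊗ q)) ∎
    where
      open SetoidReasoning ≋-setoid
      ⊕-interchange : ∀ w x y z → (w ⊕ x) ⊕ (y ⊕ z) ≋ (w ⊕ y) ⊕ (x ⊕ z)
      ⊕-interchange w x y z = begin
        (w ⊕ x) ⊕ (y ⊕ z)  ≈⟨ ⊕-assoc w x (y ⊕ z) ⟩
        w ⊕ (x ⊕ (y ⊕ z))  ≈⟨ ⊕-cong (≋-refl {w}) (≋-sym (⊕-assoc x y z)) ⟩
        w ⊕ ((x ⊕ y) ⊕ z)  ≈⟨ ⊕-cong (≋-refl {w}) (⊕-cong (⊕-comm x y) (≋-refl {z})) ⟩
        w ⊕ ((y ⊕ x) ⊕ z)  ≈⟨ ⊕-cong (≋-refl {w}) (⊕-assoc y x z) ⟩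
        w ⊕ (y ⊕ (x ⊕ z))  ≈⟨ ⊕-assoc w y (x ⊕ z) ⟨
        (w ⊕ y) ⊕ (x ⊕ z)  ∎

  scale-⊗ : ∀ a q r → scale a q ⊗ r ≋ scale a (q ⊗ r)
  scale-⊗ a []       r = tt
  scale-⊗ a (b ∷ bs) r = begin
    scale (a * b) r ⊕ (0# ∷ scale a bs ⊗ r)
      ≈⟨ ⊕-cong (≋-sym (scale-scale a b r)) (sym (zeroʳ a) , scale-⊗ a bs r) ⟩
    scale a (scale b r) ⊕ scale a (0# ∷ bs ⊗ r)
      ≈⟨ scale-distrib-⊕ a (scale b r) (0# ∷ bs ⊗ r) ⟨
    scale a (scale b r ⊕ (0# ∷ bs ⊗ r)) ∎
    where open SetoidReasoning ≋-setoid

  ⊗-assoc : ∀ p q r → (p ⊗ q) ⊗ r ≋ p ⊗ (q ⊗ r)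
  ⊗-assoc []       q r = tt
  ⊗-assoc (a ∷ as) q r = begin
    (scale a q ⊕ (0# ∷ as ⊗ q)) ⊗ r        ≈⟨ ⊗-distribʳ (scale a q) (0# ∷ as ⊗ q) r ⟩
    scale a q ⊗ r ⊕ (0# ∷ as ⊗ q) ⊗ r      ≈⟨ ⊕-cong (scale-⊗ a q r) (⊕-cong (scale-zero r) (≋-refl {0# ∷ (as ⊗ q) ⊗ r})) ⟩
    scale a (q ⊗ r) ⊕ (0# ∷ (as ⊗ q) ⊗ r)  ≈⟨ ⊕-cong (≋-refl {scale a (q ⊗ r)}) (shift-cong (⊗-assoc as q r)) ⟩
    scale a (q ⊗ r) ⊕ (0# ∷ as ⊗ (q ⊗ r))  ∎
    where open SetoidReasoning ≋-setoid

  ⊗-identityˡ : ∀ q → (1# ∷ []) ⊗ q ≋ q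
  ⊗-identityˡ q = ≋-trans (⊕-cong (scale-one q) (refl , tt)) (⊕-identityʳ q)

  ⊗-zeroʳ : ∀ p → p ⊗ [] ≋ []
  ⊗-zeroʳ []       = tt
  ⊗-zeroʳ (a ∷ as) = refl , ⊗-zeroʳ as

  ⊗-∷ʳ : ∀ p b bs → p ⊗ (b ∷ bs) ≋ scale b p ⊕ (0# ∷ p ⊗ bs)
  ⊗-∷ʳ []       b bs = ≋-sym {0# ∷ []} {[]} (refl , tt)
  ⊗-∷ʳ (a ∷ as) b bs = +-cong (*-comm a b) refl , (begin
    scale a bs ⊕ as ⊗ (b ∷ bs)                  ≈⟨ ⊕-cong (≋-refl {scale a bs}) (⊗-∷ʳ as b bs) ⟩
    scale a bs ⊕ (scale b as ⊕ (0# ∷ as ⊗ bs))  ≈⟨ ⊕-assoc (scale a bs) (scale b as) _ ⟨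
    (scale a bs ⊕ scale b as) ⊕ (0# ∷ as ⊗ bs)  ≈⟨ ⊕-cong (⊕-comm (scale a bs) (scale b as)) (≋-refl {0# ∷ as ⊗ bs}) ⟩
    (scale b as ⊕ scale a bs) ⊕ (0# ∷ as ⊗ bs)  ≈⟨ ⊕-assoc (scale b as) (scale a bs) _ ⟩
    scale b as ⊕ (scale a bs ⊕ (0# ∷ as ⊗ bs))  ∎)
    where open SetoidReasoning ≋-setoid

  ⊗-comm : ∀ p q → p ⊗ q ≋ q ⊗ p
  ⊗-comm p []       = ⊗-zeroʳ p
  ⊗-comm p (b ∷ bs) = ≋-trans (⊗-∷ʳ p b bs) (⊕-cong (≋-refl {scale b p}) (shift-cong (⊗-comm p bs)))

  isCommutativeSemiring : IsCommutativeSemiring _≋_ _⊕_ _⊗_ [] (1# ∷ [])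
  isCommutativeSemiring = isCommutativeSemiringˡ record
    { +-isCommutativeMonoid = record
      { isMonoid = record
        { isSemigroup = record
          { isMagma = record { isEquivalence = ≋-isEquivalence ; ∙-cong = ⊕-cong }
          ; assoc = ⊕-assoc }
        ; identity = (λ p → ≋-refl) , ⊕-identityʳ }
      ; comm = ⊕-comm }
    ; *-isCommutativeMonoid = record
      { isMonoid = record
        { isSemigroup = record
          { isMagma = record { isEquivalence = ≋-isEquivalence ; ∙-cong = ⊗-cong }
          ; assoc = ⊗-assoc }
        ; identity = ⊗-identityˡ , (λ p → ≋-trans (⊗-comm p _) (⊗-identityˡ p)) }
      ; comm = ⊗-comm }
    ; distribʳ = λ x y z → ⊗-distribʳ y z x
    ; zeroˡ = λ x → tt }

module Multivariate {c ℓ} (F : CommutativeRing c ℓ) where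
  open import Data.List.Base using ([]; _∷_)
  private
    A : RawSemiring c ℓ
    A = rawSR F
    module F = CommutativeRing F
    module Poly (n : ℕ) = RawSemiring (MPoly A n)

  isCommutativeSemiringₚ : ∀ n →
    IsCommutativeSemiring (Poly._≈_ n) (Poly._+_ n) (Poly._*_ n) (Poly.0# n) (Poly.1# n)
  isCommutativeSemiringₚ zero    = F.isCommutativeSemiring
  isCommutativeSemiringₚ (suc n) =
    PolynomialSemiring.isCommutativeSemiring (MPoly A n) (isCommutativeSemiringₚ n)

  semiringₚ : ℕ → CommutativeSemiring c ℓ
  semiringₚ n = record { isCommutativeSemiring = isCommutativeSemiringₚ n }

  private
    module R (n : ℕ) = CommutativeSemiring (semiringₚ n)
    module PS (n : ℕ) = PolynomialSemiring (MPoly A n) (isCommutativeSemiringₚ n)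

  const-isHomomorphism : ∀ n → IsSemiringHomomorphism A (MPoly A n) (constₚ F n)
  const-isHomomorphism n = record
    { isNearSemiringHomomorphism = record
      { +-isMonoidHomomorphism = record
        { isMagmaHomomorphism = record
          { isRelHomomorphism = record { cong = const-cong n }
          ; homo = const-+ n }
        ; ε-homo = const-0 n }
      ; *-homo = const-* n }
    ; 1#-homo = const-1 n }
    where
      const-cong : ∀ n {a b} → a F.≈ b → R._≈_ n (constₚ F n a) (constₚ F n b)
      const-cong zero    e = e
      const-cong (suc n) e = const-cong n e , tt
      const-+ : ∀ n a b → R._≈_ n (constₚ F n (a F.+ b)) (R._+_ n (constₚ F n a) (constₚ F n b))
      const-+ zero    a b = F.refl
      const-+ (suc n) a b = const-+ n a b , tt
      const-* : ∀ n a b → R._≈_ n (constₚ F n (a F.* b)) (R._*_ n (constₚ F n a) (constₚ F n b))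
      const-* zero    a b = F.refl
      const-* (suc n) a b = R.trans n (const-* n a b) (R.sym n (R.+-identityʳ n _)) , tt
      const-0 : ∀ n → R._≈_ n (constₚ F n F.0#) (R.0# n)
      const-0 zero    = F.refl
      const-0 (suc n) = const-0 n , tt
      const-1 : ∀ n → R._≈_ n (constₚ F n F.1#) (R.1# n)
      const-1 zero    = F.refl
      const-1 (suc n) = const-1 n , tt

  -- Degree bounds.  For p = p₀ + xₙ₊₁·p′ with p₀ ∈ F[x₁,…,xₙ], the bound
  -- DegLe (n + 1) d p says: p₀ has degree ≤ d and p′ has degree ≤ d − 1
  -- (p′ = 0 when d = 0).

  DegLe-0 : ∀ n {d} → DegLe A n d (R.0# n)
  DegLe-0 zero    = tt
  DegLe-0 (suc n) = tt

  DegLe-cong : ∀ n {d p q} → R._≈_ n p q → DegLe A n d p → DegLe A n d q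
  DegLe-cong zero    e D = tt
  DegLe-cong (suc n) {d}     {[]}     {[]}     e         D = tt
  DegLe-cong (suc n) {zero}  {[]}     {b ∷ bs} (b≈0 , e) D =
    DegLe-cong n (R.sym n b≈0) (DegLe-0 n) , R.sym (suc n) {[]} {bs} e
  DegLe-cong (suc n) {suc d} {[]}     {b ∷ bs} (b≈0 , e) D =
    DegLe-cong n (R.sym n b≈0) (DegLe-0 n) , DegLe-cong (suc n) {d} {[]} {bs} e tt
  DegLe-cong (suc n) {d}     {a ∷ as} {[]}     e         D = tt
  DegLe-cong (suc n) {zero}  {a ∷ as} {b ∷ bs} (a≈b , e) (Da , as≋0) =
    DegLe-cong n a≈b Da , R.trans (suc n) {bs} {as} {[]} (R.sym (suc n) {as} {bs} e) as≋0
  DegLe-cong (suc n) {suc d} {a ∷ as} {b ∷ bs} (a≈b , e) (Da , Das) =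
    DegLe-cong n a≈b Da , DegLe-cong (suc n) {d} {as} {bs} e Das

  DegLe-const : ∀ n d a → DegLe A n d (constₚ F n a)
  DegLe-const zero    d       a = tt
  DegLe-const (suc n) zero    a = DegLe-const n zero a , tt
  DegLe-const (suc n) (suc d) a = DegLe-const n (suc d) a , tt

  DegLe-+ : ∀ n {d p q} → DegLe A n d p → DegLe A n d q → DegLe A n d (R._+_ n p q)
  DegLe-+ zero    Dp Dq = tt
  DegLe-+ (suc n) {d}     {[]}     {q}      Dp Dq = Dq
  DegLe-+ (suc n) {d}     {x ∷ xs} {[]}     Dp Dq = Dp
  DegLe-+ (suc n) {zero}  {x ∷ xs} {y ∷ ys} (Dx , xs≋0) (Dy , ys≋0) =
    DegLe-+ n Dx Dy , PS.⊕-cong n {xs} {[]} {ys} {[]} xs≋0 ys≋0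
  DegLe-+ (suc n) {suc d} {x ∷ xs} {y ∷ ys} (Dx , Dxs) (Dy , Dys) =
    DegLe-+ n Dx Dy , DegLe-+ (suc n) Dxs Dys

  DegLe-∷[] : ∀ n {d x} → DegLe A n d x → DegLe A (suc n) d (x ∷ [])
  DegLe-∷[] n {zero}  Dx = Dx , tt
  DegLe-∷[] n {suc d} Dx = Dx , tt

  -- degrees add under multiplication; the scalar case x · q with
  -- x ∈ F[x₁,…,xₙ] and q ∈ F[x₁,…,xₙ₊₁] is the induction step
  mutual
    DegLe-scale : ∀ n {a b x q} → DegLe A n a x → DegLe A (suc n) b q →
                  DegLe A (suc n) (a ℕ.+ b) (PS.scale n x q)
    DegLe-scale n {q = []} Dx Dq = tt
    DegLe-scale n {a} {zero} {x} {y ∷ ys} Dx (Dy , ys≋0) =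
      DegLe-cong (suc n) (R.refl n , R.sym (suc n) (PS.scale-cong n (R.refl n) ys≋0))
        (DegLe-∷[] n (DegLe-* n Dx Dy))
    DegLe-scale n {a} {suc b} {x} {y ∷ ys} Dx (Dy , Dys) =
      ≡.subst (λ e → DegLe A (suc n) e (PS.scale n x (y ∷ ys))) (≡.sym (ℕ.+-suc a b))
        (≡.subst (λ e → DegLe A n e (R._*_ n x y)) (ℕ.+-suc a b) (DegLe-* n Dx Dy) ,
         DegLe-scale n Dx Dys)

    DegLe-* : ∀ n {a b p q} → DegLe A n a p → DegLe A n b q → DegLe A n (a ℕ.+ b) (R._*_ n p q)
    DegLe-* zero Dp Dq = tt
    DegLe-* (suc n) {p = []} Dp Dq = tt
    DegLe-* (suc n) {zero} {b} {x ∷ xs} {q} (Dx , xs≋0) Dq =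
      DegLe-cong (suc n) (R.sym (suc n) x∷xs⊗q≈xq) (DegLe-scale n {zero} Dx Dq)
      where
        open PolyOver (MPoly A n) using (_⊕_; _⊗_)
        x∷xs⊗q≈xq : R._≈_ (suc n) ((x ∷ xs) ⊗ q) (PS.scale n x q)
        x∷xs⊗q≈xq = R.trans (suc n)
          (PS.⊕-cong n {PS.scale n x q} {PS.scale n x q} {R.0# n ∷ xs ⊗ q} {[]}
             (R.refl (suc n)) (R.refl n , PS.⊗-congˡ n q xs≋0))
          (R.+-identityʳ (suc n) (PS.scale n x q))
    DegLe-* (suc n) {suc a} {b} {x ∷ xs} {q} (Dx , Dxs) Dq =
      DegLe-+ (suc n) (DegLe-scale n {suc a} Dx Dq) (DegLe-0 n , DegLe-* (suc n) Dxs Dq)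

  DegLe-^ : ∀ n {d p} k → DegLe A n d p → DegLe A n (k ℕ.* d) (_^ₚ_ F n p k)
  DegLe-^ n zero    Dp = DegLe-cong n (1#-homo (const-isHomomorphism n)) (DegLe-const n 0 F.1#)
    where open IsSemiringHomomorphism
  DegLe-^ n (suc k) Dp = DegLe-* n Dp (DegLe-^ n k Dp)

module HomomorphismProperties {a b c ℓ} (A : RawSemiring a b) (R : CommutativeSemiring c ℓ)
  (ψ : RawSemiring.Carrier A → CommutativeSemiring.Carrier R)
  (isHom : IsSemiringHomomorphism A (CommutativeSemiring.rawSemiring R) ψ) where
  open CommutativeSemiring R hiding (zero)
  open IsSemiringHomomorphism isHom
  open RSDefs rawSemiring using (_^_; sum) renaming (_×_ to _·_)
  private module A = RSDefs A

  ψ-· : ∀ m x → ψ (m A.× x) ≈ m · ψ x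
  ψ-· zero    x = 0#-homo
  ψ-· (suc m) x = trans (+-homo x (m A.× x)) (+-congˡ (ψ-· m x))

  ψ-^ : ∀ m x → ψ (x A.^ m) ≈ ψ x ^ m
  ψ-^ zero    x = 1#-homo
  ψ-^ (suc m) x = trans (*-homo x (x A.^ m)) (*-congˡ (ψ-^ m x))

  ψ-sum : ∀ {m} (f : Fin m → RawSemiring.Carrier A) → ψ (A.sum f) ≈ sum (ψ ∘ f)
  ψ-sum {zero}  f = 0#-homo
  ψ-sum {suc m} f = trans (+-homo (f zero) _) (+-congˡ (ψ-sum (f ∘ suc)))

  scaled-power-as-powers : ∀ {w} k γ (y : Fin w → RawSemiring.Carrier A) Q →
    RawSemiring._≈_ A γ (A.sum (λ j → y j A.^ k)) →
    ψ γ * Q ^ k ≈ sum (λ j → (ψ (y j) * Q) ^ k)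
  scaled-power-as-powers {w} k γ y Q γ≈∑yᵏ = begin
    ψ γ * Q ^ k                          ≈⟨ *-congʳ (trans (⟦⟧-cong γ≈∑yᵏ) (ψ-sum (λ j → y j A.^ k))) ⟩
    sum (λ j → ψ (y j A.^ k)) * Q ^ k    ≈⟨ *-congʳ (sum-cong-≋ {w} (λ j → ψ-^ k (y j))) ⟩
    sum (λ j → ψ (y j) ^ k) * Q ^ k      ≈⟨ *-distribʳ-sum (Q ^ k) (λ j → ψ (y j) ^ k) ⟩
    sum (λ j → ψ (y j) ^ k * Q ^ k)      ≈⟨ sum-cong-≋ {w} (λ j → ^-distrib-* (ψ (y j)) Q k) ⟨
    sum (λ j → (ψ (y j) * Q) ^ k)        ∎
    where
      open SetoidReasoning setoid
      open import Algebra.Properties.Semiring.Sum semiring using (sum-cong-≋; *-distribʳ-sum)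
      open import Algebra.Properties.CommutativeSemiring.Exp R using (^-distrib-*)

-- For distinct nodes b₀,…,b_r of a field there
-- are weights δ₀,…,δ_r whose moments Σᵢ δᵢ bᵢᵐ vanish for m < r and
-- equal 1 for m = r: the functional p ↦ Σᵢ δᵢ p(bᵢ) reads off the
-- coefficient of xʳ of every polynomial of degree ≤ r.  They are built
-- by induction on r, adjoining one node at a time.
module Moments {c ℓ} (F : CommutativeRing c ℓ) where
  open CommutativeRing F hiding (zero)
  open RSDefs (rawSR F) using (_^_; sum)
  open import Algebra.Properties.Ring ring
    using (-1*x≈-x; -‿distribˡ-*; x[y-z]≈xy-xz; [y-z]x≈yx-zx; x∙y⁻¹≈ε⇒x≈y)
  open import Algebra.Properties.CommutativeSemigroup *-commutativeSemigroup using (x∙yz≈y∙xz)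
  open import Algebra.Properties.Semiring.Sum semiring using (sum-cong-≋; *-distribˡ-sum; *-distribʳ-sum)
  open import Algebra.Properties.CommutativeMonoid.Sum +-commutativeMonoid using (∑-distrib-+)
  open import Data.Vec.Functional using (_∷_)
  open SetoidReasoning setoid

  moment : ∀ {s} → (Fin s → Carrier) → (Fin s → Carrier) → ℕ → Carrier
  moment b δ m = sum (λ i → δ i * b i ^ m)

  UnitAt : ℕ → (ℕ → Carrier) → Set ℓ
  UnitAt r S = (∀ m → m ℕ.< r → S m ≈ 0#) × S r ≈ 1#

  negate-sum : ∀ {s} (f : Fin s → Carrier) → - sum f ≈ sum (λ i → - f i)
  negate-sum f = begin
    - sum f                 ≈⟨ -1*x≈-x (sum f) ⟨
    - 1# * sum f            ≈⟨ *-distribˡ-sum (- 1#) f ⟩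
    sum (λ i → - 1# * f i)  ≈⟨ sum-cong-≋ (λ i → -1*x≈-x (f i)) ⟩
    sum (λ i → - f i)       ∎

  telescope : ∀ a b c → (a - b) + (b - c) ≈ a - c
  telescope a b c = begin
    (a - b) + (b - c)    ≈⟨ +-assoc a (- b) (b - c) ⟩
    a + (- b + (b - c))  ≈⟨ +-congˡ (+-assoc (- b) b (- c)) ⟨
    a + ((- b + b) - c)  ≈⟨ +-congˡ (+-congʳ (-‿inverseˡ b)) ⟩
    a + (0# - c)         ≈⟨ +-congˡ (+-identityˡ (- c)) ⟩
    a - c                ∎

  geometric : ℕ → Carrier → Carrier → Carrier
  geometric zero    x y = 1#
  geometric (suc m) x y = x ^ suc m + y * geometric m x y

  geometric-quotient : ∀ m x y → (x - y) * geometric m x y ≈ x ^ suc m - y ^ suc m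
  geometric-quotient zero    x y = [y-z]x≈yx-zx 1# x y
  geometric-quotient (suc m) x y = begin
    (x - y) * (X + y * geometric m x y)            ≈⟨ distribˡ (x - y) X _ ⟩
    (x - y) * X + (x - y) * (y * geometric m x y)  ≈⟨ +-congˡ (x∙yz≈y∙xz (x - y) y _) ⟩
    (x - y) * X + y * ((x - y) * geometric m x y)  ≈⟨ +-congˡ (*-congˡ (geometric-quotient m x y)) ⟩
    (x - y) * X + y * (X - Y)                      ≈⟨ +-cong ([y-z]x≈yx-zx X x y) (x[y-z]≈xy-xz y X Y) ⟩
    (x * X - y * X) + (y * X - y * Y)              ≈⟨ telescope (x * X) (y * X) (y * Y) ⟩
    x * X - y * Y                                  ∎
    where
      X Y : Carrier
      X = x ^ suc m
      Y = y ^ suc m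

  UnitAt-accumulate : ∀ r (S T : ℕ → Carrier) y → T 0 ≈ S 0 →
    (∀ m → T (suc m) ≈ S (suc m) + y * T m) → UnitAt r S → UnitAt r T
  UnitAt-accumulate zero    S T y T₀ T-suc (_ , S₀≈1) = (λ m ()) , trans T₀ S₀≈1
  UnitAt-accumulate (suc r) S T y T₀ T-suc (S<r≈0 , Sr≈1) = T<r≈0 , (begin
    T (suc r)              ≈⟨ T-suc r ⟩
    S (suc r) + y * T r    ≈⟨ +-cong Sr≈1 (*-congˡ (T<r≈0 r (ℕ.n<1+n r))) ⟩
    1# + y * 0#            ≈⟨ +-congˡ (zeroʳ y) ⟩
    1# + 0#                ≈⟨ +-identityʳ 1# ⟩
    1#                     ∎)
    where
      T<r≈0 : ∀ m → m ℕ.< suc r → T m ≈ 0#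
      T<r≈0 zero    m<r = trans T₀ (S<r≈0 zero m<r)
      T<r≈0 (suc m) m<r = begin
        T (suc m)              ≈⟨ T-suc m ⟩
        S (suc m) + y * T m    ≈⟨ +-cong (S<r≈0 (suc m) m<r) (*-congˡ (T<r≈0 m (ℕ.<-trans (ℕ.n<1+n m) m<r))) ⟩
        0# + y * 0#            ≈⟨ +-identityˡ _ ⟩
        y * 0#                 ≈⟨ zeroʳ y ⟩
        0#                     ∎

  -- Adjoining a node b₀ to nodes b with weights δ: with εᵢ = δᵢ/(bᵢ − b₀)
  -- the weights (−Σε, ε) at (b₀, b) have moment 0 at m = 0 and moment
  -- Σ_{j ≤ m} b₀^{m−j} · moment b δ j at m + 1, since
  -- εᵢ (bᵢ^{m+1} − b₀^{m+1}) = δᵢ · geometric m bᵢ b₀.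
  UnitAt-adjoin : ∀ {s} r b₀ (b δ ε : Fin s → Carrier) →
    (∀ i → ε i * (b i - b₀) ≈ δ i) → UnitAt r (moment b δ) →
    UnitAt (suc r) (moment (b₀ ∷ b) ((- sum ε) ∷ ε))
  UnitAt-adjoin r b₀ b δ ε ε-spec unit = moment<≈0 , trans (moment-suc r) (proj₂ T-unit)
    where
      δ′ : Fin (suc _) → Carrier
      δ′ = (- sum ε) ∷ ε

      T : ℕ → Carrier
      T m = sum (λ i → δ i * geometric m (b i) b₀)

      T-suc : ∀ m → T (suc m) ≈ moment b δ (suc m) + b₀ * T m
      T-suc m = begin
        sum (λ i → δ i * (b i ^ suc m + b₀ * geometric m (b i) b₀))
          ≈⟨ sum-cong-≋ (λ i → trans (distribˡ (δ i) _ _) (+-congˡ (x∙yz≈y∙xz (δ i) b₀ _))) ⟩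
        sum (λ i → δ i * b i ^ suc m + b₀ * (δ i * geometric m (b i) b₀))
          ≈⟨ ∑-distrib-+ (λ i → δ i * b i ^ suc m) (λ i → b₀ * (δ i * geometric m (b i) b₀)) ⟩
        moment b δ (suc m) + sum (λ i → b₀ * (δ i * geometric m (b i) b₀))
          ≈⟨ +-congˡ (*-distribˡ-sum b₀ (λ i → δ i * geometric m (b i) b₀)) ⟨
        moment b δ (suc m) + b₀ * T m ∎

      T-unit : UnitAt r T
      T-unit = UnitAt-accumulate r (moment b δ) T b₀ refl T-suc unit

      term : ∀ m i → δ i * geometric m (b i) b₀ ≈ ε i * b i ^ suc m - ε i * b₀ ^ suc m
      term m i = begin
        δ i * geometric m (b i) b₀                ≈⟨ *-congʳ (ε-spec i) ⟨
        (ε i * (b i - b₀)) * geometric m (b i) b₀  ≈⟨ *-assoc (ε i) _ _ ⟩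
        ε i * ((b i - b₀) * geometric m (b i) b₀)  ≈⟨ *-congˡ (geometric-quotient m (b i) b₀) ⟩
        ε i * (b i ^ suc m - b₀ ^ suc m)           ≈⟨ x[y-z]≈xy-xz (ε i) _ _ ⟩
        ε i * b i ^ suc m - ε i * b₀ ^ suc m      ∎

      moment-zero : moment (b₀ ∷ b) δ′ 0 ≈ 0#
      moment-zero = begin
        - sum ε * 1# + sum (λ i → ε i * 1#)  ≈⟨ +-cong (*-identityʳ _) (sum-cong-≋ (λ i → *-identityʳ (ε i))) ⟩
        - sum ε + sum ε                      ≈⟨ -‿inverseˡ _ ⟩
        0#                                   ∎

      moment-suc : ∀ m → moment (b₀ ∷ b) δ′ (suc m) ≈ T m
      moment-suc m = begin
        - sum ε * Y + sum (λ i → ε i * b i ^ suc m)          ≈⟨ +-comm _ _ ⟩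
        sum (λ i → ε i * b i ^ suc m) + - sum ε * Y          ≈⟨ +-congˡ (-‿distribˡ-* (sum ε) Y) ⟨
        sum (λ i → ε i * b i ^ suc m) + - (sum ε * Y)        ≈⟨ +-congˡ (-‿cong (*-distribʳ-sum Y ε)) ⟩
        sum (λ i → ε i * b i ^ suc m) + - sum (λ i → ε i * Y)  ≈⟨ +-congˡ (negate-sum (λ i → ε i * Y)) ⟩
        sum (λ i → ε i * b i ^ suc m) + sum (λ i → - (ε i * Y))
          ≈⟨ ∑-distrib-+ (λ i → ε i * b i ^ suc m) (λ i → - (ε i * Y)) ⟨
        sum (λ i → ε i * b i ^ suc m - ε i * Y)              ≈⟨ sum-cong-≋ (λ i → term m i) ⟨
        T m                                                  ∎
        where
          Y : Carrier
          Y = b₀ ^ suc m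

      moment<≈0 : ∀ m → m ℕ.< suc r → moment (b₀ ∷ b) δ′ m ≈ 0#
      moment<≈0 zero    _           = moment-zero
      moment<≈0 (suc m) (ℕ.s≤s m<r) = trans (moment-suc m) (proj₁ T-unit m m<r)

  interpolation-weights : IsField F → ∀ r (b : Fin (suc r) → Carrier) →
    (∀ i j → b i ≈ b j → i ≡ j) → ∃ λ δ → UnitAt r (moment b δ)
  interpolation-weights _ zero b _ =
    (λ _ → 1#) , (λ m ()) , trans (+-identityʳ _) (*-identityʳ 1#)
  interpolation-weights isField (suc r) b b-inj
    with interpolation-weights isField r (b ∘ suc) (λ i j → suc-injective ∘ b-inj (suc i) (suc j))
  ... | δ , unit = (- sum ε) ∷ ε , UnitAt-adjoin r (b zero) (b ∘ suc) δ ε ε-spec unit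
    where
      gap : Fin (suc r) → Carrier
      gap i = b (suc i) - b zero

      gap≉0 : ∀ i → ¬ (gap i ≈ 0#)
      gap≉0 i gap≈0 with b-inj (suc i) zero (x∙y⁻¹≈ε⇒x≈y _ _ gap≈0)
      ... | ()

      gap-invertible : ∀ i → ∃ λ y → gap i * y ≈ 1#
      gap-invertible i = proj₂ isField (gap i) (gap≉0 i)

      ε : Fin (suc r) → Carrier
      ε i = δ i * proj₁ (gap-invertible i)

      ε-spec : ∀ i → ε i * gap i ≈ δ i
      ε-spec i = begin
        (δ i * gap⁻¹) * gap i  ≈⟨ *-assoc (δ i) gap⁻¹ (gap i) ⟩
        δ i * (gap⁻¹ * gap i)  ≈⟨ *-congˡ (trans (*-comm gap⁻¹ (gap i)) (proj₂ (gap-invertible i))) ⟩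
        δ i * 1#               ≈⟨ *-identityʳ (δ i) ⟩
        δ i                    ∎
        where
          gap⁻¹ : Carrier
          gap⁻¹ = proj₁ (gap-invertible i)

-- With γᵢ = δᵢ/k, the j-th coefficient
--   cⱼ = Σᵢ γᵢ · (k choose j) · bᵢ^{k−j}
-- is (k choose j)/k times the moment of δ of order k − j; hence c₁ = 1
-- and cⱼ = 0 for j ≥ 2.
module KeyCoefficients {c ℓ} (F : CommutativeRing c ℓ) (r : ℕ)
  (b δ : Fin (suc r) → CommutativeRing.Carrier F)
  (unit : Moments.UnitAt F r (Moments.moment F b δ))
  (k⁻¹ : CommutativeRing.Carrier F)
  (k⁻¹-spec : CommutativeRing._≈_ F
     (CommutativeRing._*_ F (RSDefs._×_ (rawSR F) (suc r) (CommutativeRing.1# F)) k⁻¹)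
     (CommutativeRing.1# F)) where
  open CommutativeRing F hiding (zero)
  open RSDefs (rawSR F) using (_^_; sum) renaming (_×_ to _·_)
  open Moments F using (moment)
  open import Data.Nat.Combinatorics using (_C_; nC1≡n)
  open import Data.Fin.Properties using (toℕ<n)
  open import Algebra.Properties.Semiring.Sum semiring using (sum-cong-≋; *-distribˡ-sum)
  open import Algebra.Properties.Semiring.Mult semiring using (×-assoc-*)
  open import Algebra.Properties.Monoid.Mult +-monoid using (×-congˡ; ×-congʳ)
  open import Algebra.Properties.CommutativeSemigroup *-commutativeSemigroup using (interchange)
  open SetoidReasoning setoid

  k : ℕ
  k = suc r

  γ : Fin k → Carrier
  γ i = δ i * k⁻¹

  coefficient : Fin (suc k) → Carrier
  coefficient j = sum (λ i → γ i * ((k C toℕ j) · (b i ^ (k ℕ.∸ toℕ j))))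

  ×-as-* : ∀ n x → n · x ≈ (n · 1#) * x
  ×-as-* n x = begin
    n · x          ≈⟨ ×-congʳ n (*-identityˡ x) ⟨
    n · (1# * x)   ≈⟨ ×-assoc-* n 1# x ⟨
    (n · 1#) * x   ∎

  coefficient-as-moment : ∀ j →
    coefficient j ≈ ((k C toℕ j) · 1# * k⁻¹) * moment b δ (k ℕ.∸ toℕ j)
  coefficient-as-moment j = begin
    sum (λ i → (δ i * k⁻¹) * (kCj · B i)) ≈⟨ sum-cong-≋ (λ i → *-congˡ {δ i * k⁻¹} (×-as-* kCj (B i))) ⟩
    sum (λ i → (δ i * k⁻¹) * (N * B i))   ≈⟨ sum-cong-≋ (λ i → rearrange (δ i) (B i)) ⟩
    sum (λ i → (N * k⁻¹) * (δ i * B i))   ≈⟨ *-distribˡ-sum (N * k⁻¹) (λ i → δ i * B i) ⟨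
    (N * k⁻¹) * moment b δ e              ∎
    where
      kCj e : ℕ
      kCj = k C toℕ j
      e = k ℕ.∸ toℕ j
      N : Carrier
      N = kCj · 1#
      B : Fin k → Carrier
      B i = b i ^ e
      rearrange : ∀ d x → (d * k⁻¹) * (N * x) ≈ (N * k⁻¹) * (d * x)
      rearrange d x = begin
        (d * k⁻¹) * (N * x)  ≈⟨ *-congʳ (*-comm d k⁻¹) ⟩
        (k⁻¹ * d) * (N * x)  ≈⟨ interchange k⁻¹ d N x ⟩
        (k⁻¹ * N) * (d * x)  ≈⟨ *-congʳ (*-comm k⁻¹ N) ⟩
        (N * k⁻¹) * (d * x)  ∎

  coefficient₁≈1 : coefficient (suc zero) ≈ 1#
  coefficient₁≈1 = begin
    coefficient (suc zero)                ≈⟨ coefficient-as-moment (suc zero) ⟩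
    ((k C 1) · 1# * k⁻¹) * moment b δ r   ≈⟨ *-cong (*-congʳ (×-congˡ (nC1≡n k))) (proj₂ unit) ⟩
    (k · 1# * k⁻¹) * 1#                   ≈⟨ *-identityʳ _ ⟩
    k · 1# * k⁻¹                          ≈⟨ k⁻¹-spec ⟩
    1#                                    ∎

  coefficient≥2≈0 : ∀ j → coefficient (suc (suc j)) ≈ 0#
  coefficient≥2≈0 j = begin
    coefficient (suc (suc j))                    ≈⟨ coefficient-as-moment (suc (suc j)) ⟩
    (N * k⁻¹) * moment b δ (r ℕ.∸ suc (toℕ j))  ≈⟨ *-congˡ (proj₁ unit _ exponent<r) ⟩
    (N * k⁻¹) * 0#                               ≈⟨ zeroʳ _ ⟩
    0#                                           ∎
    where
      N : Carrier
      N = (k C suc (suc (toℕ j))) · 1#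
      exponent<r : r ℕ.∸ suc (toℕ j) ℕ.< r
      exponent<r = ℕ.∸-monoʳ-< (ℕ.s≤s ℕ.z≤n) (toℕ<n j)

-- In any commutative semiring R receiving F through
-- a semiring homomorphism ψ, the binomial theorem expands
--   Σᵢ ψ(γᵢ) (y + ψ(bᵢ))ᵏ = Σⱼ yʲ ψ(cⱼ) = ψ(c₀) + y,
-- so every x ∈ R equals Σᵢ ψ(γᵢ) (x − ψ(c₀) + ψ(bᵢ))ᵏ.
module KeyIdentity {c ℓ} (F : CommutativeRing c ℓ) (r : ℕ)
  (b δ : Fin (suc r) → CommutativeRing.Carrier F)
  (unit : Moments.UnitAt F r (Moments.moment F b δ))
  (k⁻¹ : CommutativeRing.Carrier F)
  (k⁻¹-spec : CommutativeRing._≈_ F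
     (CommutativeRing._*_ F (RSDefs._×_ (rawSR F) (suc r) (CommutativeRing.1# F)) k⁻¹)
     (CommutativeRing.1# F))
  {c′ ℓ′} (R : CommutativeSemiring c′ ℓ′)
  (ψ : CommutativeRing.Carrier F → CommutativeSemiring.Carrier R)
  (isHom : IsSemiringHomomorphism (rawSR F) (CommutativeSemiring.rawSemiring R) ψ) where
  open KeyCoefficients F r b δ unit k⁻¹ k⁻¹-spec
  open HomomorphismProperties (rawSR F) R ψ isHom
  open CommutativeSemiring R hiding (zero)
  open IsSemiringHomomorphism isHom using (⟦⟧-cong; +-homo; 0#-homo; 1#-homo; *-homo)
  open RSDefs rawSemiring using (_^_; sum) renaming (_×_ to _·_)
  private module S where
    open CommutativeRing F public using (_*_; _+_; -_; -‿inverseʳ)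
    open RSDefs (rawSR F) public using (_^_) renaming (_×_ to _·_)
  open import Data.Nat.Combinatorics using (_C_)
  open import Algebra.Properties.CommutativeSemiring.Binomial R using (theorem)
  open import Algebra.Properties.Semiring.Sum semiring using (sum-cong-≋; *-distribˡ-sum; sum-replicate-zero)
  open import Algebra.Properties.CommutativeMonoid.Sum +-commutativeMonoid using (∑-comm)
  open import Algebra.Properties.Semiring.Mult semiring using (×-comm-*)
  open import Algebra.Properties.CommutativeSemigroup *-commutativeSemigroup using (x∙yz≈y∙xz)
  open SetoidReasoning setoid

  binomial-term : ∀ y g x n e j →
    ψ g * (n · (y ^ j * ψ x ^ e)) ≈ y ^ j * ψ (g S.* (n S.· (x S.^ e)))
  binomial-term y g x n e j = begin
    ψ g * (n · (y ^ j * ψ x ^ e))      ≈⟨ *-congˡ (×-comm-* n (y ^ j) (ψ x ^ e)) ⟨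
    ψ g * (y ^ j * (n · ψ x ^ e))      ≈⟨ x∙yz≈y∙xz (ψ g) (y ^ j) _ ⟩
    y ^ j * (ψ g * (n · ψ x ^ e))      ≈⟨ *-congˡ (*-congˡ (trans (ψ-· n (x S.^ e)) (×-congʳ n (ψ-^ e x)))) ⟨
    y ^ j * (ψ g * ψ (n S.· x S.^ e))  ≈⟨ *-congˡ (*-homo g _) ⟨
    y ^ j * ψ (g S.* (n S.· x S.^ e))  ∎
    where open import Algebra.Properties.Monoid.Mult +-monoid using (×-congʳ)

  expansion : ∀ y → sum (λ i → ψ (γ i) * (y + ψ (b i)) ^ k) ≈ sum (λ j → y ^ toℕ j * ψ (coefficient j))
  expansion y = begin
    sum (λ i → ψ (γ i) * (y + ψ (b i)) ^ k)
      ≈⟨ sum-cong-≋ (λ i → *-congˡ {ψ (γ i)} (theorem k y (ψ (b i)))) ⟩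
    sum (λ i → ψ (γ i) * sum (λ j → term i j))
      ≈⟨ sum-cong-≋ (λ i → *-distribˡ-sum (ψ (γ i)) (λ j → term i j)) ⟩
    sum (λ i → sum (λ j → ψ (γ i) * term i j))
      ≈⟨ ∑-comm (λ i j → ψ (γ i) * term i j) ⟩
    sum (λ j → sum (λ i → ψ (γ i) * term i j))
      ≈⟨ sum-cong-≋ column ⟩
    sum (λ j → y ^ toℕ j * ψ (coefficient j)) ∎
    where
      term : Fin k → Fin (suc k) → Carrier
      term i j = (k C toℕ j) · (y ^ toℕ j * ψ (b i) ^ (k ℕ.∸ toℕ j))
      scalar : Fin (suc k) → Fin k → CommutativeRing.Carrier F
      scalar j i = γ i S.* ((k C toℕ j) S.· (b i S.^ (k ℕ.∸ toℕ j)))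
      column : ∀ j → sum (λ i → ψ (γ i) * term i j) ≈ y ^ toℕ j * ψ (coefficient j)
      column j = begin
        sum (λ i → ψ (γ i) * term i j)
          ≈⟨ sum-cong-≋ (λ i → binomial-term y (γ i) (b i) (k C toℕ j) (k ℕ.∸ toℕ j) (toℕ j)) ⟩
        sum (λ i → y ^ toℕ j * ψ (scalar j i))  ≈⟨ *-distribˡ-sum (y ^ toℕ j) (ψ ∘ scalar j) ⟨
        y ^ toℕ j * sum (λ i → ψ (scalar j i))  ≈⟨ *-congˡ (ψ-sum (scalar j)) ⟨
        y ^ toℕ j * ψ (coefficient j) ∎

  collapse : ∀ y → sum (λ i → ψ (γ i) * (y + ψ (b i)) ^ k) ≈ ψ (coefficient zero) + y
  collapse y = begin
    sum (λ i → ψ (γ i) * (y + ψ (b i)) ^ k)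
      ≈⟨ expansion y ⟩
    1# * ψ c₀ + ((y * 1#) * ψ c₁ + sum (λ j → y ^ (2 ℕ.+ toℕ j) * ψ (coefficient (suc (suc j)))))
      ≈⟨ +-cong (*-identityˡ (ψ c₀)) (+-cong (*-cong (*-identityʳ y) (trans (⟦⟧-cong coefficient₁≈1) 1#-homo)) higher≈0) ⟩
    ψ c₀ + (y * 1# + 0#)
      ≈⟨ +-congˡ (trans (+-identityʳ _) (*-identityʳ y)) ⟩
    ψ c₀ + y ∎
    where
      c₀ c₁ : CommutativeRing.Carrier F
      c₀ = coefficient zero
      c₁ = coefficient (suc zero)
      higher≈0 : sum (λ j → y ^ (2 ℕ.+ toℕ j) * ψ (coefficient (suc (suc j)))) ≈ 0#
      higher≈0 = trans
        (sum-cong-≋ (λ j → trans (*-congˡ (trans (⟦⟧-cong (coefficient≥2≈0 j)) 0#-homo)) (zeroʳ _)))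
        (sum-replicate-zero r)

  shift : Carrier → Fin k → Carrier
  shift x i = (x + ψ (S.- coefficient zero)) + ψ (b i)

  representation : ∀ x → x ≈ sum (λ i → ψ (γ i) * shift x i ^ k)
  representation x = sym (begin
    sum (λ i → ψ (γ i) * shift x i ^ k)   ≈⟨ collapse (x + ψ (S.- c₀)) ⟩
    ψ c₀ + (x + ψ (S.- c₀))               ≈⟨ x∙yz≈y∙xz′ (ψ c₀) x _ ⟩
    x + (ψ c₀ + ψ (S.- c₀))               ≈⟨ +-congˡ (+-homo c₀ (S.- c₀)) ⟨
    x + ψ (c₀ S.+ S.- c₀)                 ≈⟨ +-congˡ (trans (⟦⟧-cong (S.-‿inverseʳ c₀)) 0#-homo) ⟩
    x + 0#                                ≈⟨ +-identityʳ x ⟩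
    x                                     ∎)
    where
      c₀ : CommutativeRing.Carrier F
      c₀ = coefficient zero
      open import Algebra.Properties.CommutativeSemigroup +-commutativeSemigroup using ()
        renaming (x∙yz≈y∙xz to x∙yz≈y∙xz′)

-- Sums of k-th powers of elements satisfying a side condition Good
-- (later: a degree bound on the k-th power).
module PowerSums {c ℓ p} (R : CommutativeSemiring c ℓ) (k : ℕ)
  (Good : CommutativeSemiring.Carrier R → Set p) where
  open CommutativeSemiring R hiding (zero)
  open RSDefs rawSemiring using (_^_; sum)
  open import Data.Vec.Functional using (_++_; tail)
  open import Data.Sum.Base using (inj₁; inj₂)
  open import Algebra.Properties.Semiring.Sum semiring using (sum-cong-≋)
  open SetoidReasoning setoid

  SumOfGoodPowers : ℕ → Carrier → Set (c ⊔ ℓ ⊔ p)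
  SumOfGoodPowers s x = ∃ λ (Q : Fin s → Carrier) → x ≈ sum (λ i → Q i ^ k) × (∀ i → Good (Q i))

  private variable
    a : Level
    A : Set a
    m n : ℕ

  ++-all : ∀ {q} (Pr : A → Set q) (xs : Fin m → A) (ys : Fin n → A) →
    (∀ i → Pr (xs i)) → (∀ j → Pr (ys j)) → ∀ i → Pr ((xs ++ ys) i)
  ++-all {m = m} Pr xs ys all-xs all-ys i with splitAt m i
  ... | inj₁ j = all-xs j
  ... | inj₂ j = all-ys j

  tail-++ : ∀ (xs : Fin (suc m) → A) (ys : Fin n → A) i → (xs ++ ys) (suc i) ≡ (tail xs ++ ys) i
  tail-++ {m = m} xs ys i with splitAt m i
  ... | inj₁ j = ≡.refl
  ... | inj₂ j = ≡.refl

  sum-++ : ∀ (e : A → Carrier) (xs : Fin m → A) (ys : Fin n → A) →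
    sum (e ∘ (xs ++ ys)) ≈ sum (e ∘ xs) + sum (e ∘ ys)
  sum-++ {m = zero}  e xs ys = sym (+-identityˡ _)
  sum-++ {m = suc m} e xs ys = begin
    e (xs zero) + sum (e ∘ tail (xs ++ ys))                 ≈⟨ +-congˡ (sum-cong-≋ (λ i → reflexive (≡.cong e (tail-++ xs ys i)))) ⟩
    e (xs zero) + sum (e ∘ (tail xs ++ ys))                 ≈⟨ +-congˡ (sum-++ e (tail xs) ys) ⟩
    e (xs zero) + (sum (e ∘ tail xs) + sum (e ∘ ys))        ≈⟨ +-assoc _ _ _ ⟨
    (e (xs zero) + sum (e ∘ tail xs)) + sum (e ∘ ys)        ∎

  powers-cong : ∀ {s x y} → x ≈ y → SumOfGoodPowers s y → SumOfGoodPowers s x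
  powers-cong x≈y (Q , y≈∑Q , good) = Q , trans x≈y y≈∑Q , good

  powers-+ : ∀ {s t x y} → SumOfGoodPowers s x → SumOfGoodPowers t y → SumOfGoodPowers (s ℕ.+ t) (x + y)
  powers-+ (Q , x≈∑Q , good) (Q′ , y≈∑Q′ , good′) =
    Q ++ Q′ ,
    trans (+-cong x≈∑Q y≈∑Q′) (sym (sum-++ (_^ k) Q Q′)) ,
    ++-all Good Q Q′ good good′

  powers-sum : ∀ {m w} (f : Fin m → Carrier) →
    (∀ i → SumOfGoodPowers w (f i)) → SumOfGoodPowers (m ℕ.* w) (sum f)
  powers-sum {zero}  f each = (λ ()) , refl , λ ()
  powers-sum {suc m} f each = powers-+ (each zero) (powers-sum (f ∘ suc) (each ∘ suc))

module Representations {c ℓ} (F : CommutativeRing c ℓ) (isField : IsField F) (r : ℕ)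
  (b : Fin (suc r) → CommutativeRing.Carrier F)
  (b-inj : ∀ i j → CommutativeRing._≈_ F (b i) (b j) → i ≡ j)
  (k⁻¹ : CommutativeRing.Carrier F)
  (k⁻¹-spec : CommutativeRing._≈_ F
     (CommutativeRing._*_ F (RSDefs._×_ (rawSR F) (suc r) (CommutativeRing.1# F)) k⁻¹)
     (CommutativeRing.1# F)) where
  open Multivariate F
  private module F = CommutativeRing F

  k : ℕ
  k = suc r

  weights : ∃ λ δ → Moments.UnitAt F r (Moments.moment F b δ)
  weights = Moments.interpolation-weights F isField r b b-inj
  open KeyCoefficients F r b (proj₁ weights) (proj₂ weights) k⁻¹ k⁻¹-spec using (γ)

  module Key (n : ℕ) = KeyIdentity F r b (proj₁ weights) (proj₂ weights) k⁻¹ k⁻¹-spec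
    (semiringₚ n) (constₚ F n) (const-isHomomorphism n)

  shift-degree : ∀ n {d} P → DegLeₚ F n d P → ∀ i → DegLeₚ F n d (Key.shift n P i)
  shift-degree n P P-deg i = DegLe-+ n (DegLe-+ n P-deg (DegLe-const n _ _)) (DegLe-const n _ _)

  weighted-powers : ∀ n d (P : Pol F n) → DegLeₚ F n d P →
    ∃ λ (δ : Fin k → F.Carrier) → ∃ λ (Q : Fin k → Pol F n) →
      _≈ₚ_ F n P (∑ₚ F n (λ i → _*ₚ_ F n (constₚ F n (δ i)) (_^ₚ_ F n (Q i) k)))
      × (∀ i → DegLeₚ F n (k ℕ.* d) (_^ₚ_ F n (Q i) k))
  weighted-powers n d P P-deg =
    γ , Key.shift n P , Key.representation n P , λ i → DegLe-^ n k (shift-degree n P P-deg i)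

  -- if every element of F is a sum of w k-th powers, then P is a sum of
  -- k · w k-th powers: each γᵢ Qᵢᵏ = Σⱼ (yᵢⱼ Qᵢ)ᵏ where γᵢ = Σⱼ yᵢⱼᵏ
  sum-of-powers : ∀ w → (∀ a → SumOfPowers F k w a) → ∀ n d (P : Pol F n) → DegLeₚ F n d P →
    ∃ λ (Q : Fin (k ℕ.* w) → Pol F n) →
      _≈ₚ_ F n P (∑ₚ F n (λ i → _^ₚ_ F n (Q i) k))
      × (∀ i → DegLeₚ F n (k ℕ.* d) (_^ₚ_ F n (Q i) k))
  sum-of-powers w waring n d P P-deg =
    powers-cong (Key.representation n P) (powers-sum _ term-as-powers)
    where
      open PowerSums (semiringₚ n) k (λ q → DegLeₚ F n (k ℕ.* d) (_^ₚ_ F n q k))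
      open HomomorphismProperties (rawSR F) (semiringₚ n) (constₚ F n) (const-isHomomorphism n)
      term-as-powers : ∀ i → SumOfGoodPowers w (_*ₚ_ F n (constₚ F n (γ i)) (_^ₚ_ F n (Key.shift n P i) k))
      term-as-powers i =
        (λ j → _*ₚ_ F n (constₚ F n (y j)) Qᵢ) ,
        scaled-power-as-powers k (γ i) y Qᵢ γᵢ≈∑yᵏ ,
        λ j → DegLe-^ n k (DegLe-* n {0} (DegLe-const n 0 (y j)) (shift-degree n P P-deg i))
        where
          Qᵢ : Pol F n
          Qᵢ = Key.shift n P i
          y : Fin w → F.Carrier
          y = proj₁ (waring (γ i))
          γᵢ≈∑yᵏ : γ i F.≈ RSDefs.sum (rawSR F) (λ j → RSDefs._^_ (rawSR F) (y j) k)
          γᵢ≈∑yᵏ = proj₂ (waring (γ i))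

open import Data.Nat.Base using (_≤_; _*_)
open import Data.Nat.Divisibility using (_∣_)

-- Only k ≥ 1 and the first half of IsWaringNumber (every element is a
-- sum of w k-th powers) are needed; the representation uses k of the
-- k + 1 distinct elements as interpolation nodes.
corollary3p2 : ∀ {c ℓ} (F : CommutativeRing c ℓ) → IsField F →
    (k : ℕ) → 2 ≤ k → MoreThan F k →
    (Σ ℕ λ p → IsCharacteristic F p × ¬ (p ∣ k)) →
    (∀ n d (P : Pol F n) → HasDegreeₚ F n d P →
      ∃ λ (δ : Fin k → CommutativeRing.Carrier F) → ∃ λ (Q : Fin k → Pol F n) →
        _≈ₚ_ F n P (∑ₚ F n (λ i → _*ₚ_ F n (constₚ F n (δ i)) (_^ₚ_ F n (Q i) k)))
        × (∀ i → DegLeₚ F n (k * d) (_^ₚ_ F n (Q i) k)))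
    ×
    (∀ w → IsWaringNumber F k w →
      ∀ n d (P : Pol F n) → HasDegreeₚ F n d P →
        ∃ λ s → s ≤ k * w × ∃ λ (Q : Fin s → Pol F n) →
          _≈ₚ_ F n P (∑ₚ F n (λ i → _^ₚ_ F n (Q i) k))
          × (∀ i → DegLeₚ F n (k * d) (_^ₚ_ F n (Q i) k)))
corollary3p2 F isField zero    () _ _
corollary3p2 F isField (suc r) _  (f , f-inj) (p , char , p∤k) =
  (λ n d P P-deg → weighted-powers n d P (proj₁ P-deg)) ,
  (λ w W n d P P-deg → suc r * w , ℕ.≤-refl , sum-of-powers w (proj₁ W) n d P (proj₁ P-deg))
  where
    open CommutativeRing F using (_≈_; 1#; 0#) renaming (_*_ to _⋆_)
    open RSDefs (rawSR F) using () renaming (_×_ to _·_)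

    k·1≉0 : ¬ (suc r · 1# ≈ 0#)
    k·1≉0 = p∤k ∘ proj₁ (char (suc r))

    k⁻¹ : ∃ λ x → (suc r · 1#) ⋆ x ≈ 1#
    k⁻¹ = proj₂ isField (suc r · 1#) k·1≉0

    open Representations F isField r (f ∘ suc) (λ i j → suc-injective ∘ f-inj (suc i) (suc j))
      (proj₁ k⁻¹) (proj₂ k⁻¹)
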